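{- Let $F$ be a star network of order $n$ with interior vertices $x_1,\dots,x_m$, let $\pi\in\Pi(F)$, and let $k\in[m]$. For paths $\pi_i,\pi_j$ of $\pi$ passing through $x_k$, the triple $(\pi_i,\pi_j,k)$ is a defect if and only if $i<j$ and $\pi_j\prec\pi_i$ (relative to $x_k$).
   Context: A planar network of order $n$ is a directed, planar, acyclic multigraph embedded in the plane with $n$ source vertices on the left and $n$ sink vertices on the right, each labeled $1,\dots,n$ from bottom to top; edges may carry a positive integer multiplicity. For an interval $[a,b]\subseteq[n]$ (possibly empty), the simple star network $F_{[a,b]}$ has one interior vertex $x$, edges source $i\to x$ and $x\to$ sink $i$ for $i\in[a,b]$, and an edge source $i\to$ sink $i$ for $i\notin[a,b]$. The concatenation $E\circ F$ is obtained by deleting sink $i$ of $E$ and source $i$ of $F$ for each $i$ and merging each edge of $E$ ending at sink $i$ with each edge of $F$ starting at source $i$ into one edge. The condensed concatenation $E\bullet F$ is obtained from $E\circ F$ by replacing, for each pair of interior vertices joined by $p>1$ parallel edges, these edges by a single edge of multiplicity $p$. A star network $F=F_{[a_1,b_1]}\cdots F_{[a_m,b_m]}$ is any network built from $F_{[a_1,b_1]},\dots,F_{[a_m,b_m]}$ (in this order) by any combination of concatenations and condensed concatenations; its interior vertices are $x_1,\dots,x_m$. A covering path family $\pi=(\pi_1,\dots,\pi_n)\in\Pi(F)$ is a sequence of source-to-sink paths, $\pi_i$ starting at source $i$, such that each edge of multiplicity $p$ lies on exactly $p$ of the paths. The intersection of two paths has components that are single vertices or paths $(x_k,\dots,x_\ell)$;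 the two paths meet at the initial vertex $x_k$ of each component, and the component is a crossing if the paths enter $x_k$ and exit $x_\ell$ in different vertical orders. A defect of $\pi$ at $x_k$ is a triple $(\pi_i,\pi_j,k)$ with $i<j$ such that $\pi_i,\pi_j$ meet at $x_k$ after having crossed an odd number of times. For paths through $x_k$, $\pi_a\prec\pi_b$ means $\pi_a$ enters $x_k$ on an edge strictly below the edge on which $\pi_b$ enters $x_k$ (in the planar embedding). -}

module Defs where

open import Data.Nat using (ℕ; zero; suc; _+_; _∸_; _≤_; _<_; _≡ᵇ_; _≤ᵇ_; _<ᵇ_)
open import Data.Nat.Properties using ()
open import Data.Bool using (Bool; true; false; _∧_; _∨_; not; if_then_else_; T; _xor_)
open import Data.List using (List; []; _∷_; length)
open import Data.Maybe using (Maybe; just; nothing)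
open import Data.Product using (Σ; _×_; _,_; ∃)
open import Relation.Binary.PropositionalEquality using (_≡_)

-- Star networks, as build trees.
-- leaf a b      : the simple star network F_[a,b]  (empty when a > b)
-- E ∘ₛ F        : concatenation
-- E •ₛ F        : condensed concatenation
-- The leaves, read left to right, are F_[a_1,b_1], ..., F_[a_m,b_m];
-- interior vertex x_k (1 ≤ k ≤ m) belongs to the k-th leaf.

data Star : Set where
  leaf : ℕ → ℕ → Star
  _∘ₛ_ : Star → Star → Star
  _•ₛ_ : Star → Star → Star

size : Star → ℕ
size (leaf a b) = 1
size (E ∘ₛ F) = size E + size F
size (E •ₛ F) = size E + size F

WF : ℕ → Star → Set
WF n (leaf a b) = a ≤ b → (1 ≤ a × b ≤ n)
WF n (E ∘ₛ F) = WF n E × WF n F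
WF n (E •ₛ F) = WF n E × WF n F

stop : Star → ℕ → ℕ → Bool
stop (leaf a b) k i = (k ≡ᵇ 1) ∧ ((a ≤ᵇ i) ∧ (i ≤ᵇ b))
stop (E ∘ₛ F) k i = if k ≤ᵇ size E then stop E k i else stop F (k ∸ size E) i
stop (E •ₛ F) k i = if k ≤ᵇ size E then stop E k i else stop F (k ∸ size E) i

-- cond F k l (for 1 ≤ k < l ≤ m) : the parallel edges x_k → x_l are
-- condensed, i.e. some condensed concatenation in the build tree has
-- both x_k and x_l among its interior vertices.
cond : Star → ℕ → ℕ → Bool
cond (leaf a b) k l = false
cond (E ∘ₛ F) k l =
  if l ≤ᵇ size E then cond E k l
  else (if size E <ᵇ k then cond F (k ∸ size E) (l ∸ size E) else false)
cond (E •ₛ F) k l = true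

countTo : (ℕ → Bool) → ℕ → ℕ
countTo f zero = zero
countTo f (suc N) = countTo f N + (if f (suc N) then 1 else 0)

anyTo : (ℕ → Bool) → ℕ → Bool
anyTo f zero = false
anyTo f (suc N) = anyTo f N ∨ f (suc N)

-- least i ∈ [1,N] with f i (0 if none)
firstTo : (ℕ → Bool) → ℕ → ℕ
firstTo f zero = zero
firstTo f (suc N) = if anyTo f N then firstTo f N else (if f (suc N) then suc N else zero)

noneBetween : (ℕ → Bool) → ℕ → ℕ → Bool
noneBetween f p q = not (anyTo (λ h → (p <ᵇ h) ∧ f h) (q ∸ 1))

data V : Set where
  src : ℕ → V
  int : ℕ → V
  snk : ℕ → V

_==V_ : V → V → Bool
src i ==V src j = i ≡ᵇ j
int i ==V int j = i ≡ᵇ j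
snk i ==V snk j = i ≡ᵇ j
_ ==V _ = false

pos : ℕ → V → ℕ
pos m (src _) = 0
pos m (int k) = k
pos m (snk _) = suc m

visits : Star → ℕ → V → Bool
visits F i (src j) = i ≡ᵇ j
visits F i (snk j) = i ≡ᵇ j
visits F i (int k) = (1 ≤ᵇ k) ∧ ((k ≤ᵇ size F) ∧ stop F k i)

-- seg n F i u v : in the uncondensed concatenation there is an edge
-- u → v coming from level i (consecutive stops of the wire at level i)
seg : ℕ → Star → ℕ → V → V → Bool
seg n F i u v =
  (1 ≤ᵇ i) ∧ ((i ≤ᵇ n) ∧ (visits F i u ∧ (visits F i v ∧
  ((pos (size F) u <ᵇ pos (size F) v) ∧
   noneBetween (λ h → stop F h i) (pos (size F) u) (pos (size F) v)))))

data Edge : Set where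
  wireE : ℕ → V → V → Edge   -- a (non-condensed) edge u → v of level i
  condE : ℕ → ℕ → Edge

_==E_ : Edge → Edge → Bool
wireE i u v ==E wireE j u' v' = (i ≡ᵇ j) ∧ ((u ==V u') ∧ (v ==V v'))
condE k l ==E condE k' l' = (k ≡ᵇ k') ∧ (l ≡ᵇ l')
_ ==E _ = false

tailE : Edge → V
tailE (wireE i u v) = u
tailE (condE k l) = int k

headE : Edge → V
headE (wireE i u v) = v
headE (condE k l) = int l

condPair : Star → V → V → Bool
condPair F (int k) (int l) = cond F k l
condPair F _ _ = false

isEdge : ℕ → Star → Edge → Bool
isEdge n F (wireE i u v) = seg n F i u v ∧ not (condPair F u v)
isEdge n F (condE k l) = cond F k l ∧ anyTo (λ i → seg n F i (int k) (int l)) n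

mult : ℕ → Star → Edge → ℕ
mult n F (wireE i u v) = 1
mult n F (condE k l) = countTo (λ i → seg n F i (int k) (int l)) n

-- vertical position of an edge in the planar embedding: its level;
-- a condensed edge is drawn along its lowest wire level
level : ℕ → Star → Edge → ℕ
level n F (wireE i u v) = i
level n F (condE k l) = firstTo (λ i → seg n F i (int k) (int l)) n

Walk : ℕ → Star → V → List Edge → Set
Walk n F u [] = ∃ λ j → u ≡ snk j
Walk n F u (e ∷ es) = T (isEdge n F e) × (tailE e ≡ u × Walk n F (headE e) es)

usesB : List Edge → Edge → Bool
usesB [] e = false
usesB (e' ∷ es) e = (e' ==E e) ∨ usesB es e

-- π ∈ Π(F) : π t is a path from source t (1 ≤ t ≤ n), and every edge of
-- multiplicity p lies on exactly p of the paths π 1, ..., π n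
CoveringFamily : ℕ → Star → (ℕ → List Edge) → Set
CoveringFamily n F π =
  ((t : ℕ) → 1 ≤ t → t ≤ n → Walk n F (src t) (π t)) ×
  ((e : Edge) → T (isEdge n F e) → countTo (λ t → usesB (π t) e) n ≡ mult n F e)

inEdge : List Edge → V → Maybe Edge
inEdge [] v = nothing
inEdge (e ∷ es) v = if headE e ==V v then just e else inEdge es v

outEdge : List Edge → V → Maybe Edge
outEdge [] v = nothing
outEdge (e ∷ es) v = if tailE e ==V v then just e else outEdge es v

passes : List Edge → V → Set
passes p v = ∃ λ e → inEdge p v ≡ just e

sameEdge : Maybe Edge → Maybe Edge → Bool
sameEdge (just e) (just e') = e ==E e'
sameEdge _ _ = false

bothAt : List Edge → List Edge → V → Bool
bothAt p q v with inEdge p v | inEdge q v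
... | just _ | just _ = true
... | _ | _ = false

-- p and q meet at v: v is the initial vertex of a component of their
-- intersection (common vertex, not entered along a common edge)
meetsB : List Edge → List Edge → V → Bool
meetsB p q v = bothAt p q v ∧ not (sameEdge (inEdge p v) (inEdge q v))

belowM : ℕ → Star → Maybe Edge → Maybe Edge → Bool
belowM n F (just e) (just e') = level n F e <ᵇ level n F e'
belowM n F _ _ = false

-- terminal vertex of the intersection component starting at v
-- (follow common outgoing edges; fuel bounds the length)
compEnd : ℕ → List Edge → List Edge → V → V
compEnd zero p q v = v
compEnd (suc fuel) p q v with outEdge p v | outEdge q v
... | just e | just e' = if e ==E e' then compEnd fuel p q (headE e) else v
... | _ | _ = v

crossingB : ℕ → Star → List Edge → List Edge → V → Bool
crossingB n F p q v =
  belowM n F (inEdge p v) (inEdge q v) xor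
  belowM n F (outEdge p w) (outEdge q w)
  where w = compEnd (length p) p q v

crossingsBefore : ℕ → Star → List Edge → List Edge → ℕ → ℕ
crossingsBefore n F p q k =
  countTo (λ h → meetsB p q (int h) ∧ crossingB n F p q (int h)) (k ∸ 1)

Odd : ℕ → Set
Odd zero = Data.Bool.T false
Odd (suc zero) = Data.Bool.T true
Odd (suc (suc a)) = Odd a

Defect : ℕ → Star → (ℕ → List Edge) → ℕ → ℕ → ℕ → Set
Defect n F π i j k =
  i < j × (T (meetsB (π i) (π j) (int k)) × Odd (crossingsBefore n F (π i) (π j) k))

Prec : ℕ → Star → (ℕ → List Edge) → ℕ → ℕ → ℕ → Set
Prec n F π k a b = ∃ λ e → ∃ λ e' →
  inEdge (π a) (int k) ≡ just e × (inEdge (π b) (int k) ≡ just e' × level n F e < level n F e')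

{-# OPTIONS --safe #-}

-- Cut the network between consecutive interior vertices. Across each cut a path uses exactly one
-- edge, and distinct edges across the same cut lie on distinct wire levels. Sweeping the cuts from
-- left to right, the parity of the crossings met so far records whether π_j currently runs below
-- π_i. This holds at the sources because i < j. At a vertex visited by only one of the two paths,
-- the interval of that vertex contains the levels on which that path enters and leaves it but not
-- the level of the other path, so the order is unchanged; at a vertex where the paths meet, the
-- count changes exactly when the component starting there swaps them. At x_k this says that an
-- odd number of earlier crossings means π_j enters x_k below π_i.

module Submission where

open import Defs
open import Data.Bool using (Bool; true; false; _∧_; not; if_then_else_; T; T?; _xor_)
open import Data.Bool.Properties
  using (T-≡; T-not-≡; T-∧; ∨-conicalˡ; ∨-conicalʳ; not-involutive; not-distribˡ-xor; xor-identityʳ)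
open import Data.Empty using (⊥; ⊥-elim)
open import Data.List using (List; []; _∷_; length)
open import Data.List.Relation.Unary.All using (All; []; _∷_)
open import Data.Maybe using (just; nothing)
open import Data.Maybe.Properties using (just-injective)
open import Data.Nat
  using (ℕ; zero; suc; _+_; _∸_; _≤_; _<_; _≮_; z≤n; s≤s; s≤s⁻¹; _≡ᵇ_; _≤ᵇ_; _<ᵇ_)
open import Data.Nat.Properties
open import Data.Product using (_×_; _,_; proj₁; proj₂)
open import Data.Sum using (inj₁; inj₂)
open import Function using (_∘_)
open import Function.Bundles using (_⇔_; mk⇔; Equivalence)
open import Relation.Binary.Definitions using (DecidableEquality; tri<; tri≈; tri>)
open import Relation.Binary.PropositionalEquality
open import Relation.Nullary using (¬_; yes; no)
open import Relation.Nullary.Decidable using (dec-true; dec-false; map′)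
open ≡-Reasoning

≡⇒T : ∀ {b} → b ≡ true → T b
≡⇒T = Equivalence.from T-≡

T-∧⁻ : ∀ {a b} → T (a ∧ b) → T a × T b
T-∧⁻ {a} = Equivalence.to (T-∧ {a})

T-∧⁺ : ∀ {a b} → T a → T b → T (a ∧ b)
T-∧⁺ {a} p q = Equivalence.from (T-∧ {a}) (p , q)

T-not-contra : ∀ {b} → T b → T (not b) → ⊥
T-not-contra {true} _ ()

not-xor-cancel : ∀ a x → not a xor (a xor x) ≡ not x
not-xor-cancel true x = refl
not-xor-cancel false x = refl

<ᵇ-true : ∀ {m n} → m < n → (m <ᵇ n) ≡ true
<ᵇ-true {m} {n} = dec-true (m <? n)

<ᵇ-false : ∀ {m n} → m ≮ n → (m <ᵇ n) ≡ false
<ᵇ-false {m} {n} = dec-false (m <? n)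

<ᵇ-true⁻ : ∀ {m n} → (m <ᵇ n) ≡ true → m < n
<ᵇ-true⁻ {m} {n} eq = <ᵇ⇒< m n (≡⇒T eq)

<ᵇ-false⁻ : ∀ {m n} → (m <ᵇ n) ≡ false → n ≤ m
<ᵇ-false⁻ eq = ≮⇒≥ (λ m<n → subst T eq (<⇒<ᵇ m<n))

<ᵇ-flip : ∀ {x y} → x ≢ y → (y <ᵇ x) ≡ not (x <ᵇ y)
<ᵇ-flip {x} {y} x≢y with <-cmp x y
... | tri< x<y _ _ = trans (<ᵇ-false (<-asym x<y)) (cong not (sym (<ᵇ-true x<y)))
... | tri≈ _ x≡y _ = ⊥-elim (x≢y x≡y)
... | tri> _ _ y<x = trans (<ᵇ-true y<x) (cong not (sym (<ᵇ-false (<-asym y<x))))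

parity : ℕ → Bool
parity zero = false
parity (suc m) = not (parity m)

Odd⇒parity : ∀ m → Odd m → parity m ≡ true
Odd⇒parity (suc zero) _ = refl
Odd⇒parity (suc (suc m)) odd = trans (not-involutive (parity m)) (Odd⇒parity m odd)

parity⇒Odd : ∀ m → parity m ≡ true → Odd m
parity⇒Odd (suc zero) _ = _
parity⇒Odd (suc (suc m)) eq = parity⇒Odd m (trans (sym (not-involutive (parity m))) eq)

parity-+ : ∀ m n → parity (m + n) ≡ parity m xor parity n
parity-+ zero n = refl
parity-+ (suc m) n = trans (cong not (parity-+ m n)) (not-distribˡ-xor (parity m) (parity n))

parity-countTo-suc : ∀ f N → parity (countTo f (suc N)) ≡ parity (countTo f N) xor f (suc N)
parity-countTo-suc f N =
  trans (parity-+ (countTo f N) _) (cong (parity (countTo f N) xor_) (parity-indicator (f (suc N))))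
  where
  parity-indicator : ∀ b → parity (if b then 1 else 0) ≡ b
  parity-indicator true = refl
  parity-indicator false = refl

anyTo-false : ∀ f N → anyTo f N ≡ false → ∀ {h} → 1 ≤ h → h ≤ N → f h ≡ false
anyTo-false f zero _ (s≤s _) ()
anyTo-false f (suc N) none 1≤h h≤1+N with m≤n⇒m<n∨m≡n h≤1+N
... | inj₁ h≤N = anyTo-false f N (∨-conicalˡ _ _ none) 1≤h (s≤s⁻¹ h≤N)
... | inj₂ refl = ∨-conicalʳ (anyTo f N) _ none

firstTo-satisfies : ∀ f N → T (anyTo f N) → T (f (firstTo f N))
firstTo-satisfies f (suc N) some with anyTo f N in before
... | true = firstTo-satisfies f N (≡⇒T before)
... | false with f (suc N) in last
...   | true = ≡⇒T last

noneBetween-sound : ∀ f {p q h} → T (noneBetween f p q) → p < h → h < q → ¬ T (f h)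
noneBetween-sound f {p} {suc q} none p<h (s≤s h≤q) fh =
  subst T (anyTo-false _ q (Equivalence.to T-not-≡ none) (≤-trans (s≤s z≤n) p<h) h≤q)
    (T-∧⁺ (<⇒<ᵇ p<h) fh)

==V⇒≡ : ∀ u v → T (u ==V v) → u ≡ v
==V⇒≡ (src i) (src j) eq = cong src (≡ᵇ⇒≡ i j eq)
==V⇒≡ (int i) (int j) eq = cong int (≡ᵇ⇒≡ i j eq)
==V⇒≡ (snk i) (snk j) eq = cong snk (≡ᵇ⇒≡ i j eq)
==V⇒≡ (src _) (int _) ()
==V⇒≡ (src _) (snk _) ()
==V⇒≡ (int _) (src _) ()
==V⇒≡ (int _) (snk _) ()
==V⇒≡ (snk _) (src _) ()
==V⇒≡ (snk _) (int _) ()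

==V-refl : ∀ v → T (v ==V v)
==V-refl (src i) = ≡⇒≡ᵇ i i refl
==V-refl (int i) = ≡⇒≡ᵇ i i refl
==V-refl (snk i) = ≡⇒≡ᵇ i i refl

_≟V_ : DecidableEquality V
u ≟V v = map′ (==V⇒≡ u v) (λ { refl → ==V-refl u }) (T? (u ==V v))

==V-true : ∀ {u v} → u ≡ v → (u ==V v) ≡ true
==V-true {u} {v} = dec-true (u ≟V v)

==V-false : ∀ {u v} → u ≢ v → (u ==V v) ≡ false
==V-false {u} {v} = dec-false (u ≟V v)

==E⇒≡ : ∀ e e′ → T (e ==E e′) → e ≡ e′
==E⇒≡ (wireE i u v) (wireE i′ u′ v′) eq
  with i≡ , uv≡ ← T-∧⁻ {i ≡ᵇ i′} eq
  with u≡ , v≡ ← T-∧⁻ {u ==V u′} uv≡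
  with refl ← ≡ᵇ⇒≡ i i′ i≡ | refl ← ==V⇒≡ u u′ u≡ | refl ← ==V⇒≡ v v′ v≡ = refl
==E⇒≡ (condE k l) (condE k′ l′) eq
  with k≡ , l≡ ← T-∧⁻ {k ≡ᵇ k′} eq
  with refl ← ≡ᵇ⇒≡ k k′ k≡ | refl ← ≡ᵇ⇒≡ l l′ l≡ = refl
==E⇒≡ (wireE _ _ _) (condE _ _) ()
==E⇒≡ (condE _ _) (wireE _ _ _) ()

==E-refl : ∀ e → T (e ==E e)
==E-refl (wireE i u v) = T-∧⁺ (≡⇒≡ᵇ i i refl) (T-∧⁺ (==V-refl u) (==V-refl v))
==E-refl (condE k l) = T-∧⁺ (≡⇒≡ᵇ k k refl) (≡⇒≡ᵇ l l refl)

_≟E_ : DecidableEquality Edge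
e ≟E e′ = map′ (==E⇒≡ e e′) (λ { refl → ==E-refl e }) (T? (e ==E e′))

==E-true : ∀ {e e′} → e ≡ e′ → (e ==E e′) ≡ true
==E-true {e} {e′} = dec-true (e ≟E e′)

==E-false : ∀ {e e′} → e ≢ e′ → (e ==E e′) ≡ false
==E-false {e} {e′} = dec-false (e ≟E e′)

stop-convex : ∀ F k {x y z} → T (stop F k x) → T (stop F k z) → x ≤ y → y ≤ z → T (stop F k y)
stop-convex (leaf a b) k {x} {y} {z} sx sz x≤y y≤z with k ≡ᵇ 1
... | false = sx
... | true = T-∧⁺ (≤⇒≤ᵇ (≤-trans (≤ᵇ⇒≤ a x (proj₁ (T-∧⁻ sx))) x≤y))
                 (≤⇒≤ᵇ (≤-trans y≤z (≤ᵇ⇒≤ z b (proj₂ (T-∧⁻ {a ≤ᵇ z} sz)))))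
stop-convex (E ∘ₛ G) k sx sz x≤y y≤z with k ≤ᵇ size E
... | true = stop-convex E k sx sz x≤y y≤z
... | false = stop-convex G (k ∸ size E) sx sz x≤y y≤z
stop-convex (E •ₛ G) k sx sz x≤y y≤z with k ≤ᵇ size E
... | true = stop-convex E k sx sz x≤y y≤z
... | false = stop-convex G (k ∸ size E) sx sz x≤y y≤z

module _ (F : Star) (k : ℕ) {x y c : ℕ}
  (sx : T (stop F k x)) (sy : T (stop F k y)) (¬sc : ¬ T (stop F k c)) where

  outside-<ᵇ-inside : (c <ᵇ x) ≡ (c <ᵇ y)
  outside-<ᵇ-inside with c <? x | c <? y
  ... | yes c<x | yes c<y = trans (<ᵇ-true c<x) (sym (<ᵇ-true c<y))
  ... | no c≮x | no c≮y = trans (<ᵇ-false c≮x) (sym (<ᵇ-false c≮y))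
  ... | yes c<x | no c≮y = ⊥-elim (¬sc (stop-convex F k sy sx (≮⇒≥ c≮y) (<⇒≤ c<x)))
  ... | no c≮x | yes c<y = ⊥-elim (¬sc (stop-convex F k sx sy (≮⇒≥ c≮x) (<⇒≤ c<y)))

  inside-<ᵇ-outside : (x <ᵇ c) ≡ (y <ᵇ c)
  inside-<ᵇ-outside with x <? c | y <? c
  ... | yes x<c | yes y<c = trans (<ᵇ-true x<c) (sym (<ᵇ-true y<c))
  ... | no x≮c | no y≮c = trans (<ᵇ-false x≮c) (sym (<ᵇ-false y≮c))
  ... | yes x<c | no y≮c = ⊥-elim (¬sc (stop-convex F k sx sy (<⇒≤ x<c) (≮⇒≥ y≮c)))
  ... | no x≮c | yes y<c = ⊥-elim (¬sc (stop-convex F k sy sx (<⇒≤ y<c) (≮⇒≥ x≮c)))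

module Geometry (n : ℕ) (F : Star) where

  M : ℕ
  M = size F

  P : V → ℕ
  P = pos M

  Valid : Edge → Set
  Valid e = T (isEdge n F e)

  lv : Edge → ℕ
  lv = level n F

  Spans : ℕ → Edge → Set
  Spans g e = P (tailE e) ≤ g × g < P (headE e)

  record Segment (L : ℕ) (u v : V) : Set where
    field
      visits-tail : T (visits F L u)
      visits-head : T (visits F L v)
      tail<head : P u < P v
      no-stop-between : ∀ {h} → P u < h → h < P v → ¬ T (stop F h L)

  seg⇒Segment : ∀ {L u v} → T (seg n F L u v) → Segment L u v
  seg⇒Segment {L} {u} {v} s
    with _ , s₁ ← T-∧⁻ {1 ≤ᵇ L} s
    with _ , s₂ ← T-∧⁻ {L ≤ᵇ n} s₁
    with vu , s₃ ← T-∧⁻ {visits F L u} s₂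
    with vv , s₄ ← T-∧⁻ {visits F L v} s₃
    with u<v , none ← T-∧⁻ {P u <ᵇ P v} s₄ = record
      { visits-tail = vu
      ; visits-head = vv
      ; tail<head = <ᵇ⇒< (P u) (P v) u<v
      ; no-stop-between = noneBetween-sound (λ h → stop F h L) none
      }

  edge-segment : ∀ e → Valid e → Segment (lv e) (tailE e) (headE e)
  edge-segment (wireE i u v) valid = seg⇒Segment (proj₁ (T-∧⁻ {seg n F i u v} valid))
  edge-segment (condE k l) valid =
    seg⇒Segment (firstTo-satisfies (λ i → seg n F i (int k) (int l)) n (proj₂ (T-∧⁻ {cond F k l} valid)))

  visits-int : ∀ {L k} → T (visits F L (int k)) → 1 ≤ k × k ≤ M × T (stop F k L)
  visits-int {L} {k} v
    with 1≤k , v₁ ← T-∧⁻ {1 ≤ᵇ k} v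
    with k≤M , s ← T-∧⁻ {k ≤ᵇ M} v₁ = ≤ᵇ⇒≤ 1 k 1≤k , ≤ᵇ⇒≤ k M k≤M , s

  visits-pos-≤ : ∀ {L} v → T (visits F L v) → P v ≤ suc M
  visits-pos-≤ (src _) _ = z≤n
  visits-pos-≤ (int k) v = m≤n⇒m≤1+n (proj₁ (proj₂ (visits-int v)))
  visits-pos-≤ (snk _) _ = ≤-refl

  visits-pos-injective : ∀ {L} u u′ → T (visits F L u) → T (visits F L u′) → P u ≡ P u′ → u ≡ u′
  visits-pos-injective {L} (src a) (src b) va vb _ = cong src (trans (sym (≡ᵇ⇒≡ L a va)) (≡ᵇ⇒≡ L b vb))
  visits-pos-injective {L} (snk a) (snk b) va vb _ = cong snk (trans (sym (≡ᵇ⇒≡ L a va)) (≡ᵇ⇒≡ L b vb))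
  visits-pos-injective (int a) (int b) _ _ a≡b = cong int a≡b
  visits-pos-injective (src _) (int _) _ vb 0≡b = ⊥-elim (<⇒≢ (proj₁ (visits-int vb)) 0≡b)
  visits-pos-injective (int _) (src _) va _ a≡0 = ⊥-elim (<⇒≢ (proj₁ (visits-int va)) (sym a≡0))
  visits-pos-injective (int _) (snk _) va _ a≡1+M =
    ⊥-elim (<⇒≢ (s≤s (proj₁ (proj₂ (visits-int va)))) a≡1+M)
  visits-pos-injective (snk _) (int _) _ vb 1+M≡b =
    ⊥-elim (<⇒≢ (s≤s (proj₁ (proj₂ (visits-int vb)))) (sym 1+M≡b))
  visits-pos-injective (src _) (snk _) _ _ ()
  visits-pos-injective (snk _) (src _) _ _ ()

  Segment-avoids : ∀ {L a b} → Segment L a b → ∀ w → T (visits F L w) → P a < P w → P w < P b → ⊥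
  Segment-avoids s (src _) _ a<w _ = n≮0 a<w
  Segment-avoids s (int h) vw a<w w<b = Segment.no-stop-between s a<w w<b (proj₂ (proj₂ (visits-int vw)))
  Segment-avoids {b = b} s (snk _) _ _ w<b = <⇒≱ w<b (visits-pos-≤ b (Segment.visits-head s))

  segments-spanning-gap-unique : ∀ {L u v u′ v′ g} → Segment L u v → Segment L u′ v′ →
    P u ≤ g → g < P v → P u′ ≤ g → g < P v′ → u ≡ u′ × v ≡ v′
  segments-spanning-gap-unique {u = u} {v} {u′} {v′} s s′ u≤g g<v u′≤g g<v′ = tails , heads
    where
    open Segment
    tails : u ≡ u′
    tails with <-cmp (P u) (P u′)
    ... | tri< u<u′ _ _ = ⊥-elim (Segment-avoids s u′ (visits-tail s′) u<u′ (≤-<-trans u′≤g g<v))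
    ... | tri≈ _ u≡u′ _ = visits-pos-injective u u′ (visits-tail s) (visits-tail s′) u≡u′
    ... | tri> _ _ u′<u = ⊥-elim (Segment-avoids s′ u (visits-tail s) u′<u (≤-<-trans u≤g g<v′))
    heads : v ≡ v′
    heads with <-cmp (P v) (P v′)
    ... | tri< v<v′ _ _ = ⊥-elim (Segment-avoids s′ v (visits-head s) (≤-<-trans u′≤g g<v) v<v′)
    ... | tri≈ _ v≡v′ _ = visits-pos-injective v v′ (visits-head s) (visits-head s′) v≡v′
    ... | tri> _ _ v′<v = ⊥-elim (Segment-avoids s v′ (visits-head s′) (≤-<-trans u≤g g<v′) v′<v)

  -- A wire segment between two vertices joined by a condensed edge is not itself an edge.
  edge-determined : ∀ e e′ → Valid e → Valid e′ → lv e ≡ lv e′ →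
    tailE e ≡ tailE e′ → headE e ≡ headE e′ → e ≡ e′
  edge-determined (wireE _ _ _) (wireE _ _ _) _ _ refl refl refl = refl
  edge-determined (condE _ _) (condE _ _) _ _ _ refl refl = refl
  edge-determined (wireE i _ _) (condE k l) ve ve′ _ refl refl =
    ⊥-elim (T-not-contra (proj₁ (T-∧⁻ {cond F k l} ve′)) (proj₂ (T-∧⁻ {seg n F i (int k) (int l)} ve)))
  edge-determined (condE k l) (wireE i _ _) ve ve′ _ refl refl =
    ⊥-elim (T-not-contra (proj₁ (T-∧⁻ {cond F k l} ve)) (proj₂ (T-∧⁻ {seg n F i (int k) (int l)} ve′)))

  spanning-edges-unique : ∀ {g} e e′ → Valid e → Valid e′ → Spans g e → Spans g e′ →
    lv e ≡ lv e′ → e ≡ e′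
  spanning-edges-unique e e′ ve ve′ (t≤g , g<h) (t′≤g , g<h′) same-level =
    edge-determined e e′ ve ve′ same-level (proj₁ same-ends) (proj₂ same-ends)
    where
    segment′ : Segment (lv e) (tailE e′) (headE e′)
    segment′ = subst (λ L → Segment L (tailE e′) (headE e′)) (sym same-level) (edge-segment e′ ve′)
    same-ends = segments-spanning-gap-unique (edge-segment e ve) segment′ t≤g g<h t′≤g g<h′

  edge-tail<head : ∀ e → Valid e → P (tailE e) < P (headE e)
  edge-tail<head e ve = Segment.tail<head (edge-segment e ve)

  edge-stops-at-head : ∀ e {h} → Valid e → headE e ≡ int h → T (stop F h (lv e))
  edge-stops-at-head e ve eq =
    proj₂ (proj₂ (visits-int (subst (T ∘ visits F (lv e)) eq (Segment.visits-head (edge-segment e ve)))))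

  edge-stops-at-tail : ∀ e {h} → Valid e → tailE e ≡ int h → T (stop F h (lv e))
  edge-stops-at-tail e ve eq =
    proj₂ (proj₂ (visits-int (subst (T ∘ visits F (lv e)) eq (Segment.visits-tail (edge-segment e ve)))))

  edge-skips : ∀ e {h} → Valid e → P (tailE e) < h → h < P (headE e) → ¬ T (stop F h (lv e))
  edge-skips e ve = Segment.no-stop-between (edge-segment e ve)

  edge-from-source : ∀ e {t} → Valid e → tailE e ≡ src t → lv e ≡ t
  edge-from-source e@(wireE i _ _) {t} ve refl = ≡ᵇ⇒≡ i t (Segment.visits-tail (edge-segment e ve))
  edge-from-source (condE _ _) _ ()

module Walks (n : ℕ) (F : Star) where
  open Geometry n F

  -- The edge of a path over the gap between positions g and g + 1 (junk past the sink).
  edgeAcross : List Edge → ℕ → Edge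
  edgeAcross [] g = condE 0 0
  edgeAcross (e ∷ es) g = if g <ᵇ P (headE e) then e else edgeAcross es g

  walk-valid : ∀ {u es} → Walk n F u es → All Valid es
  walk-valid {es = []} _ = []
  walk-valid {es = e ∷ es} (ve , _ , w) = ve ∷ walk-valid w

  walk-sink-beyond : ∀ {u g} → Walk n F u [] → P u ≤ g → ¬ g ≤ M
  walk-sink-beyond (_ , refl) 1+M≤g g≤M = 1+n≰n (≤-trans 1+M≤g g≤M)

  edgeAcross-spans : ∀ {u es g} → Walk n F u es → P u ≤ g → g ≤ M →
    Valid (edgeAcross es g) × Spans g (edgeAcross es g)
  edgeAcross-spans {es = []} w u≤g g≤M = ⊥-elim (walk-sink-beyond w u≤g g≤M)
  edgeAcross-spans {es = e ∷ es} {g} (ve , refl , w) u≤g g≤M with g <ᵇ P (headE e) in g<h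
  ... | true = ve , u≤g , <ᵇ-true⁻ g<h
  ... | false = edgeAcross-spans w (<ᵇ-false⁻ g<h) g≤M

  inEdge-before : ∀ {v es h} → Walk n F v es → h ≤ P v → inEdge es (int h) ≡ nothing
  inEdge-before {es = []} _ _ = refl
  inEdge-before {es = e ∷ es} {h} (ve , refl , w) h≤t
    rewrite ==V-false {headE e} {int h}
              (λ eq → <⇒≱ (edge-tail<head e ve) (subst (λ x → P x ≤ P (tailE e)) (sym eq) h≤t))
    = inEdge-before w (≤-trans h≤t (<⇒≤ (edge-tail<head e ve)))

  outEdge-before : ∀ {v es h} → Walk n F v es → h < P v → outEdge es (int h) ≡ nothing
  outEdge-before {es = []} _ _ = refl
  outEdge-before {es = e ∷ es} {h} (ve , refl , w) h<t
    rewrite ==V-false {tailE e} {int h} (λ eq → <-irrefl (cong P (sym eq)) h<t)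
    = outEdge-before w (<-trans h<t (edge-tail<head e ve))

  inEdge-edgeAcross : ∀ {u es g} → Walk n F u es → P u ≤ g → suc g ≤ M →
    inEdge es (int (suc g)) ≡
      (if headE (edgeAcross es g) ==V int (suc g) then just (edgeAcross es g) else nothing)
  inEdge-edgeAcross {es = []} w u≤g g<M = ⊥-elim (walk-sink-beyond w u≤g (<⇒≤ g<M))
  inEdge-edgeAcross {es = e ∷ es} {g} (ve , refl , w) u≤g g<M with headE e ==V int (suc g) in arrives
  ... | true rewrite ==V⇒≡ (headE e) (int (suc g)) (≡⇒T arrives) | <ᵇ-true (n<1+n g) | arrives = refl
  ... | false with g <ᵇ P (headE e) in g<h
  ...   | true rewrite arrives = inEdge-before w (<ᵇ-true⁻ g<h)
  ...   | false = inEdge-edgeAcross w (<ᵇ-false⁻ g<h) g<M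

  outEdge-edgeAcross : ∀ {u es h} → Walk n F u es → P u ≤ h → h ≤ M →
    outEdge es (int h) ≡ (if tailE (edgeAcross es h) ==V int h then just (edgeAcross es h) else nothing)
  outEdge-edgeAcross {es = []} w u≤h h≤M = ⊥-elim (walk-sink-beyond w u≤h h≤M)
  outEdge-edgeAcross {es = e ∷ es} {h} (ve , refl , w) u≤h h≤M with tailE e ==V int h in departs
  ... | true
    rewrite <ᵇ-true (subst (λ v → P v < P (headE e)) (==V⇒≡ (tailE e) (int h) (≡⇒T departs))
                           (edge-tail<head e ve))
          | departs = refl
  ... | false with h <ᵇ P (headE e) in h<t
  ...   | true rewrite departs = outEdge-before w (<ᵇ-true⁻ h<t)
  ...   | false = outEdge-edgeAcross w (<ᵇ-false⁻ h<t) h≤M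

  pos≡⇒int : ∀ {v g} → suc g ≤ M → P v ≡ suc g → v ≡ int (suc g)
  pos≡⇒int {int _} _ eq = cong int eq
  pos≡⇒int {snk _} g<M refl = ⊥-elim (1+n≰n g<M)

  edgeAcross-stays : ∀ {u es g} → Walk n F u es → P u ≤ g → suc g ≤ M →
    headE (edgeAcross es g) ≢ int (suc g) → edgeAcross es (suc g) ≡ edgeAcross es g
  edgeAcross-stays {es = []} _ _ _ _ = refl
  edgeAcross-stays {es = e ∷ es} {g} (ve , refl , w) u≤g g<M bypass with g <ᵇ P (headE e) in g<h
  ... | true rewrite <ᵇ-true {suc g} {P (headE e)} (≤∧≢⇒< (<ᵇ-true⁻ g<h) (bypass ∘ pos≡⇒int g<M ∘ sym)) = refl
  ... | false rewrite <ᵇ-false {suc g} {P (headE e)} (λ lt → <⇒≱ lt (m≤n⇒m≤1+n (<ᵇ-false⁻ g<h)))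
    = edgeAcross-stays w (<ᵇ-false⁻ g<h) g<M bypass

  edgeAcross-next : ∀ {u es g} → Walk n F u es → P u ≤ g → suc g ≤ M →
    headE (edgeAcross es g) ≡ int (suc g) → tailE (edgeAcross es (suc g)) ≡ int (suc g)
  edgeAcross-next {es = []} w u≤g g<M _ = ⊥-elim (walk-sink-beyond w u≤g (<⇒≤ g<M))
  edgeAcross-next {es = e ∷ es} {g} (ve , refl , w) u≤g g<M arrives with g <ᵇ P (headE e) in g<h
  ... | true rewrite <ᵇ-false {suc g} {P (headE e)} (<-irrefl (cong P (sym arrives))) = departs es w
    where
    departs : ∀ es → Walk n F (headE e) es → tailE (edgeAcross es (suc g)) ≡ int (suc g)
    departs [] (_ , at-sink) with () ← trans (sym arrives) at-sink
    departs (e′ ∷ es′) (ve′ , tail≡ , _)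
      rewrite <ᵇ-true (subst (λ v → P v < P (headE e′)) (trans tail≡ arrives) (edge-tail<head e′ ve′))
      = trans tail≡ arrives
  ... | false rewrite <ᵇ-false {suc g} {P (headE e)} (λ lt → <⇒≱ lt (m≤n⇒m≤1+n (<ᵇ-false⁻ g<h)))
    = edgeAcross-next w (<ᵇ-false⁻ g<h) g<M arrives

  edgeAcross-source : ∀ {t es} → Walk n F (src t) es → lv (edgeAcross es 0) ≡ t
  edgeAcross-source {es = []} (_ , ())
  edgeAcross-source {es = e ∷ es} (ve , tail≡ , _)
    rewrite <ᵇ-true (≤-<-trans z≤n (edge-tail<head e ve)) = edge-from-source e ve tail≡

  record Enters (es : List Edge) (g : ℕ) : Set where
    field
      arrives : headE (edgeAcross es g) ≡ int (suc g)
      inEdge-at : inEdge es (int (suc g)) ≡ just (edgeAcross es g)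
      outEdge-at : outEdge es (int (suc g)) ≡ just (edgeAcross es (suc g))
      arrival-inside : T (stop F (suc g) (lv (edgeAcross es g)))
      departure-inside : T (stop F (suc g) (lv (edgeAcross es (suc g))))

  record Bypasses (es : List Edge) (g : ℕ) : Set where
    field
      inEdge-none : inEdge es (int (suc g)) ≡ nothing
      edgeAcross-same : edgeAcross es (suc g) ≡ edgeAcross es g
      outside : ¬ T (stop F (suc g) (lv (edgeAcross es g)))

  module _ {t es} (w : Walk n F (src t) es) {g} (g<M : suc g ≤ M) where

    enters : headE (edgeAcross es g) ≡ int (suc g) → Enters es g
    enters arrives = record
      { arrives = arrives
      ; inEdge-at = trans (inEdge-edgeAcross w z≤n g<M)
          (cong (λ b → if b then just (edgeAcross es g) else nothing) (==V-true arrives))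
      ; outEdge-at = trans (outEdge-edgeAcross w z≤n g<M)
          (cong (λ b → if b then just (edgeAcross es (suc g)) else nothing) (==V-true departs))
      ; arrival-inside = edge-stops-at-head (edgeAcross es g) (valid-at (<⇒≤ g<M)) arrives
      ; departure-inside = edge-stops-at-tail (edgeAcross es (suc g)) (valid-at g<M) departs
      }
      where
      departs : tailE (edgeAcross es (suc g)) ≡ int (suc g)
      departs = edgeAcross-next w z≤n g<M arrives
      valid-at : ∀ {h} → h ≤ M → Valid (edgeAcross es h)
      valid-at h≤M = proj₁ (edgeAcross-spans w z≤n h≤M)

    bypasses : headE (edgeAcross es g) ≢ int (suc g) → Bypasses es g
    bypasses bypass with valid , t≤g , g<h ← edgeAcross-spans w z≤n (<⇒≤ g<M) = record
      { inEdge-none = trans (inEdge-edgeAcross w z≤n g<M)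
          (cong (λ b → if b then just (edgeAcross es g) else nothing) (==V-false bypass))
      ; edgeAcross-same = edgeAcross-stays w z≤n g<M bypass
      ; outside = edge-skips (edgeAcross es g) valid (s≤s t≤g) (≤∧≢⇒< g<h (bypass ∘ pos≡⇒int g<M ∘ sym))
      }

    passes⇒Enters : passes es (int (suc g)) → Enters es g
    passes⇒Enters (e , in≡) with headE (edgeAcross es g) ≟V int (suc g)
    ... | yes arrives = enters arrives
    ... | no bypass with () ← trans (sym in≡) (Bypasses.inEdge-none (bypasses bypass))

module ComponentEnd (n : ℕ) (F : Star) where
  open Geometry n F

  startsAtOrAfter : V → Edge → ℕ
  startsAtOrAfter v e = if P (tailE e) <ᵇ P v then 0 else 1

  startsAtOrAfter-antitone : ∀ e a b → P a ≤ P b → startsAtOrAfter b e ≤ startsAtOrAfter a e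
  startsAtOrAfter-antitone e a b a≤b with P (tailE e) <ᵇ P b in t<b
  ... | true = z≤n
  ... | false rewrite <ᵇ-false {P (tailE e)} {P a} (λ t<a → <⇒≱ (<-≤-trans t<a a≤b) (<ᵇ-false⁻ t<b))
    = ≤-refl

  -- Bounds the number of steps compEnd takes from v, so that the fuel length p used in crossingB
  -- always suffices.
  edgesFrom : List Edge → V → ℕ
  edgesFrom [] v = 0
  edgesFrom (e ∷ es) v = startsAtOrAfter v e + edgesFrom es v

  edgesFrom-antitone : ∀ es a b → P a ≤ P b → edgesFrom es b ≤ edgesFrom es a
  edgesFrom-antitone [] _ _ _ = z≤n
  edgesFrom-antitone (e ∷ es) a b a≤b =
    +-mono-≤ (startsAtOrAfter-antitone e a b a≤b) (edgesFrom-antitone es a b a≤b)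

  edgesFrom-≤-length : ∀ es v → edgesFrom es v ≤ length es
  edgesFrom-≤-length [] v = z≤n
  edgesFrom-≤-length (e ∷ es) v with P (tailE e) <ᵇ P v
  ... | true = m≤n⇒m≤1+n (edgesFrom-≤-length es v)
  ... | false = s≤s (edgesFrom-≤-length es v)

  outEdge-valid : ∀ {es v e} → All Valid es → outEdge es v ≡ just e → Valid e × tailE e ≡ v
  outEdge-valid {e′ ∷ es} {v} (ve′ ∷ valid) out with tailE e′ ==V v in departs
  ... | true with refl ← out = ve′ , ==V⇒≡ (tailE e′) v (≡⇒T departs)
  ... | false = outEdge-valid valid out

  edgesFrom-decreasing : ∀ {es v e} → All Valid es → outEdge es v ≡ just e →
    edgesFrom es (headE e) < edgesFrom es v
  edgesFrom-decreasing {e′ ∷ es} {v} {e} (ve′ ∷ valid) out with tailE e′ ==V v in departs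
  ... | true with refl ← out with refl ← ==V⇒≡ (tailE e′) v (≡⇒T departs)
    rewrite <ᵇ-true (edge-tail<head e′ ve′) | <ᵇ-false (<-irrefl {P (tailE e′)} refl)
    = s≤s (edgesFrom-antitone es (tailE e′) (headE e′) (<⇒≤ (edge-tail<head e′ ve′)))
  ... | false with ve , departs′ ← outEdge-valid valid out =
    +-mono-≤-< (startsAtOrAfter-antitone e′ v (headE e) v≤h) (edgesFrom-decreasing valid out)
    where
    v≤h = subst (λ x → P x ≤ P (headE e)) departs′ (<⇒≤ (edge-tail<head e ve))

  module _ {p : List Edge} (q : List Edge) (valid : All Valid p) where

    compEnd-fuel-irrelevant : ∀ f f′ v → edgesFrom p v ≤ f → edgesFrom p v ≤ f′ →
      compEnd f p q v ≡ compEnd f′ p q v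
    compEnd-fuel-irrelevant zero zero v _ _ = refl
    compEnd-fuel-irrelevant zero (suc f′) v ≤0 _ with outEdge p v in out | outEdge q v
    ... | nothing | _ = refl
    ... | just e | _ = ⊥-elim (n≮0 (<-≤-trans (edgesFrom-decreasing valid out) ≤0))
    compEnd-fuel-irrelevant (suc f) zero v ≤1+f ≤0 = sym (compEnd-fuel-irrelevant zero (suc f) v ≤0 ≤1+f)
    compEnd-fuel-irrelevant (suc f) (suc f′) v ≤1+f ≤1+f′ with outEdge p v in out | outEdge q v
    ... | nothing | _ = refl
    ... | just e | nothing = refl
    ... | just e | just e′ with e ==E e′
    ...   | false = refl
    ...   | true =
      compEnd-fuel-irrelevant f f′ (headE e)
        (s≤s⁻¹ (<-≤-trans shorter ≤1+f)) (s≤s⁻¹ (<-≤-trans shorter ≤1+f′))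
      where shorter = edgesFrom-decreasing valid out

    compEnd-together : ∀ {v e} → outEdge p v ≡ just e → outEdge q v ≡ just e →
      compEnd (length p) p q v ≡ compEnd (length p) p q (headE e)
    compEnd-together {v} {e} out-p out-q with length p | edgesFrom-≤-length p v
    ... | zero | ≤0 = ⊥-elim (n≮0 (<-≤-trans (edgesFrom-decreasing valid out-p) ≤0))
    ... | suc f | ≤1+f rewrite out-p | out-q | ==E-true (refl {x = e}) =
      compEnd-fuel-irrelevant f (suc f) (headE e) (s≤s⁻¹ shorter) (<⇒≤ shorter)
      where shorter = <-≤-trans (edgesFrom-decreasing valid out-p) ≤1+f

  compEnd-apart : ∀ {p q v e e′} → outEdge p v ≡ just e → outEdge q v ≡ just e′ → e ≢ e′ →
    compEnd (length p) p q v ≡ v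
  compEnd-apart {[]} ()
  compEnd-apart {_ ∷ _} out-p out-q e≢e′ rewrite out-p | out-q | ==E-false e≢e′ = refl

meetsB-just : ∀ {p q v a b} → inEdge p v ≡ just a → inEdge q v ≡ just b → meetsB p q v ≡ not (a ==E b)
meetsB-just {p} {q} {v} in-p in-q with inEdge p v | inEdge q v
meetsB-just refl refl | just _ | just _ = refl

meetsB-nothingˡ : ∀ {p q v} → inEdge p v ≡ nothing → meetsB p q v ≡ false
meetsB-nothingˡ {p} {q} {v} in-p with inEdge p v
meetsB-nothingˡ refl | nothing = refl

meetsB-nothingʳ : ∀ {p q v} → inEdge q v ≡ nothing → meetsB p q v ≡ false
meetsB-nothingʳ {p} {q} {v} in-q with inEdge p v | inEdge q v
meetsB-nothingʳ refl | nothing | nothing = refl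
meetsB-nothingʳ refl | just _ | nothing = refl

module CrossingParity (n : ℕ) (F : Star) (π : ℕ → List Edge) {i j : ℕ}
  (walk-i : Walk n F (src i) (π i)) (walk-j : Walk n F (src j) (π j)) (i<j : i < j) where
  open Geometry n F
  open Walks n F
  open ComponentEnd n F

  cᵢ cⱼ : ℕ → Edge
  cᵢ = edgeAcross (π i)
  cⱼ = edgeAcross (π j)

  exitsBelow : V → Bool
  exitsBelow v = belowM n F (outEdge (π i) v) (outEdge (π j) v)

  end : V → V
  end = compEnd (length (π i)) (π i) (π j)

  crossingAt : ℕ → Bool
  crossingAt h = meetsB (π i) (π j) (int h) ∧ crossingB n F (π i) (π j) (int h)

  crossings : ℕ → ℕ
  crossings = countTo crossingAt

  -- While the paths share an edge, the crossing status of their current component was already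
  -- counted at its initial vertex, and is determined by the order in which they leave its end.
  record Consistent (b : Bool) (eᵢ eⱼ : Edge) : Set where
    field
      together : eᵢ ≡ eⱼ → b ≡ not (exitsBelow (end (headE eᵢ)))
      apart : eᵢ ≢ eⱼ → b ≡ (lv eⱼ <ᵇ lv eᵢ)
  open Consistent

  consistent-together : ∀ {b eᵢ eⱼ} → eᵢ ≡ eⱼ → b ≡ not (exitsBelow (end (headE eᵢ))) →
    Consistent b eᵢ eⱼ
  consistent-together same b≡ = record { together = λ _ → b≡ ; apart = λ apart → ⊥-elim (apart same) }

  consistent-apart : ∀ {b eᵢ eⱼ} → eᵢ ≢ eⱼ → b ≡ (lv eⱼ <ᵇ lv eᵢ) → Consistent b eᵢ eⱼ
  consistent-apart apart b≡ = record { together = λ same → ⊥-elim (apart same) ; apart = λ _ → b≡ }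

  Invariant : ℕ → Set
  Invariant g = Consistent (parity (crossings g)) (cᵢ g) (cⱼ g)

  levels-differ : ∀ {g} → g ≤ M → cᵢ g ≢ cⱼ g → lv (cᵢ g) ≢ lv (cⱼ g)
  levels-differ {g} g≤M apart
    with validᵢ , spansᵢ ← edgeAcross-spans walk-i z≤n g≤M
       | validⱼ , spansⱼ ← edgeAcross-spans walk-j z≤n g≤M
    = apart ∘ spanning-edges-unique (cᵢ g) (cⱼ g) validᵢ validⱼ spansᵢ spansⱼ

  inside-outside-distinct : ∀ {h e e′} → T (stop F h (lv e)) → ¬ T (stop F h (lv e′)) → e ≢ e′
  inside-outside-distinct inside outside refl = outside inside

  parity-unchanged : ∀ {g} → crossingAt (suc g) ≡ false →
    parity (crossings (suc g)) ≡ parity (crossings g)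
  parity-unchanged {g} none = trans (parity-countTo-suc crossingAt g)
    (trans (cong (parity (crossings g) xor_) none) (xor-identityʳ (parity (crossings g))))

  no-meeting⇒no-crossing : ∀ {h} → meetsB (π i) (π j) (int h) ≡ false → crossingAt h ≡ false
  no-meeting⇒no-crossing {h} none = cong (_∧ crossingB n F (π i) (π j) (int h)) none

  invariant-start : Invariant 0
  invariant-start = consistent-apart
    (λ same → <⇒≢ i<j (trans (sym sourceᵢ) (trans (cong lv same) sourceⱼ)))
    (sym (<ᵇ-false (λ j<i → <-asym i<j (subst₂ _<_ sourceⱼ sourceᵢ j<i))))
    where
    sourceᵢ = edgeAcross-source walk-i
    sourceⱼ = edgeAcross-source walk-j

  invariant-bypass : ∀ {g} → Bypasses (π i) g → Bypasses (π j) g → Invariant g → Invariant (suc g)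
  invariant-bypass {g} bᵢ bⱼ inv =
    subst₂ (Consistent _) (sym (edgeAcross-same bᵢ)) (sym (edgeAcross-same bⱼ))
      (subst (λ b → Consistent b (cᵢ g) (cⱼ g)) (sym unchanged) inv)
    where
    open Bypasses
    unchanged = parity-unchanged (no-meeting⇒no-crossing (meetsB-nothingˡ {π i} {π j} (inEdge-none bᵢ)))

  invariant-enterᵢ : ∀ {g} → Enters (π i) g → Bypasses (π j) g → Invariant g → Invariant (suc g)
  invariant-enterᵢ {g} eᵢ bⱼ inv = consistent-apart
    (λ same → inside-outside-distinct (departure-inside eᵢ) (outside bⱼ) (trans same (edgeAcross-same bⱼ)))
    (begin
      parity (crossings (suc g))
        ≡⟨ parity-unchanged (no-meeting⇒no-crossing (meetsB-nothingʳ {π i} {π j} (inEdge-none bⱼ))) ⟩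
      parity (crossings g)
        ≡⟨ apart inv (inside-outside-distinct (arrival-inside eᵢ) (outside bⱼ)) ⟩
      lv (cⱼ g) <ᵇ lv (cᵢ g)
        ≡⟨ outside-<ᵇ-inside F (suc g) (arrival-inside eᵢ) (departure-inside eᵢ) (outside bⱼ) ⟩
      lv (cⱼ g) <ᵇ lv (cᵢ (suc g))
        ≡⟨ cong (λ e → lv e <ᵇ lv (cᵢ (suc g))) (edgeAcross-same bⱼ) ⟨
      lv (cⱼ (suc g)) <ᵇ lv (cᵢ (suc g)) ∎)
    where
    open Enters
    open Bypasses

  invariant-enterⱼ : ∀ {g} → Bypasses (π i) g → Enters (π j) g → Invariant g → Invariant (suc g)
  invariant-enterⱼ {g} bᵢ eⱼ inv = consistent-apart
    (λ same → inside-outside-distinct (departure-inside eⱼ) (outside bᵢ)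
                (trans (sym same) (edgeAcross-same bᵢ)))
    (begin
      parity (crossings (suc g))
        ≡⟨ parity-unchanged (no-meeting⇒no-crossing (meetsB-nothingˡ {π i} {π j} (inEdge-none bᵢ))) ⟩
      parity (crossings g)
        ≡⟨ apart inv (λ same → inside-outside-distinct (arrival-inside eⱼ) (outside bᵢ) (sym same)) ⟩
      lv (cⱼ g) <ᵇ lv (cᵢ g)
        ≡⟨ inside-<ᵇ-outside F (suc g) (arrival-inside eⱼ) (departure-inside eⱼ) (outside bᵢ) ⟩
      lv (cⱼ (suc g)) <ᵇ lv (cᵢ g)
        ≡⟨ cong (λ e → lv (cⱼ (suc g)) <ᵇ lv e) (edgeAcross-same bᵢ) ⟨
      lv (cⱼ (suc g)) <ᵇ lv (cᵢ (suc g)) ∎)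
    where
    open Enters
    open Bypasses

  crossingAt-arriving-together : ∀ {g} → Enters (π i) g → Enters (π j) g → cᵢ g ≡ cⱼ g →
    crossingAt (suc g) ≡ false
  crossingAt-arriving-together eᵢ eⱼ same
    rewrite Enters.inEdge-at eᵢ | Enters.inEdge-at eⱼ | ==E-true same = refl

  crossingAt-arriving-apart : ∀ {g} → Enters (π i) g → Enters (π j) g → cᵢ g ≢ cⱼ g →
    crossingAt (suc g) ≡ (lv (cᵢ g) <ᵇ lv (cⱼ g)) xor exitsBelow (end (int (suc g)))
  crossingAt-arriving-apart eᵢ eⱼ apart′
    rewrite Enters.inEdge-at eᵢ | Enters.inEdge-at eⱼ | ==E-false apart′ = refl

  parity-at-shared-vertex : ∀ {g} → suc g ≤ M → Enters (π i) g → Enters (π j) g → Invariant g →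
    parity (crossings (suc g)) ≡ not (exitsBelow (end (int (suc g))))
  parity-at-shared-vertex {g} g<M eᵢ eⱼ inv with cᵢ g ≟E cⱼ g
  ... | yes same = begin
      parity (crossings (suc g))
        ≡⟨ parity-unchanged (crossingAt-arriving-together eᵢ eⱼ same) ⟩
      parity (crossings g)
        ≡⟨ together inv same ⟩
      not (exitsBelow (end (headE (cᵢ g))))
        ≡⟨ cong (λ v → not (exitsBelow (end v))) (Enters.arrives eᵢ) ⟩
      not (exitsBelow (end (int (suc g)))) ∎
  ... | no apart′ = begin
      parity (crossings (suc g))
        ≡⟨ parity-countTo-suc crossingAt g ⟩
      parity (crossings g) xor crossingAt (suc g)
        ≡⟨ cong₂ _xor_ (apart inv apart′) (crossingAt-arriving-apart eᵢ eⱼ apart′) ⟩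
      (lv (cⱼ g) <ᵇ lv (cᵢ g)) xor (i-below xor exit)
        ≡⟨ cong (_xor (i-below xor exit)) (<ᵇ-flip (levels-differ (<⇒≤ g<M) apart′)) ⟩
      not i-below xor (i-below xor exit)
        ≡⟨ not-xor-cancel i-below exit ⟩
      not exit ∎
    where
    i-below = lv (cᵢ g) <ᵇ lv (cⱼ g)
    exit = exitsBelow (end (int (suc g)))

  invariant-after-shared-vertex : ∀ {g} → suc g ≤ M → Enters (π i) g → Enters (π j) g →
    parity (crossings (suc g)) ≡ not (exitsBelow (end (int (suc g)))) → Invariant (suc g)
  invariant-after-shared-vertex {g} g<M eᵢ eⱼ parity≡ with cᵢ (suc g) ≟E cⱼ (suc g)
  ... | yes same = consistent-together same (trans parity≡ (cong (not ∘ exitsBelow) stays-together))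
    where
    open Enters
    stays-together : end (int (suc g)) ≡ end (headE (cᵢ (suc g)))
    stays-together = compEnd-together (π j) (walk-valid walk-i)
      (outEdge-at eᵢ) (trans (outEdge-at eⱼ) (cong just (sym same)))
  ... | no apart′ = consistent-apart apart′ (begin
      parity (crossings (suc g))
        ≡⟨ parity≡ ⟩
      not (exitsBelow (end (int (suc g))))
        ≡⟨ cong (not ∘ exitsBelow) (compEnd-apart {π i} {π j} (outEdge-at eᵢ) (outEdge-at eⱼ) apart′) ⟩
      not (exitsBelow (int (suc g)))
        ≡⟨ cong not (cong₂ (belowM n F) (outEdge-at eᵢ) (outEdge-at eⱼ)) ⟩
      not (lv (cᵢ (suc g)) <ᵇ lv (cⱼ (suc g)))
        ≡⟨ <ᵇ-flip (levels-differ g<M apart′) ⟨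
      lv (cⱼ (suc g)) <ᵇ lv (cᵢ (suc g)) ∎)
    where open Enters

  invariant : ∀ g → g ≤ M → Invariant g
  invariant zero _ = invariant-start
  invariant (suc g) g<M
    with invariant g (<⇒≤ g<M) | headE (cᵢ g) ≟V int (suc g) | headE (cⱼ g) ≟V int (suc g)
  ... | inv | yes aᵢ | yes aⱼ =
    invariant-after-shared-vertex g<M eᵢ eⱼ (parity-at-shared-vertex g<M eᵢ eⱼ inv)
    where
    eᵢ = enters walk-i g<M aᵢ
    eⱼ = enters walk-j g<M aⱼ
  ... | inv | yes aᵢ | no bⱼ = invariant-enterᵢ (enters walk-i g<M aᵢ) (bypasses walk-j g<M bⱼ) inv
  ... | inv | no bᵢ | yes aⱼ = invariant-enterⱼ (bypasses walk-i g<M bᵢ) (enters walk-j g<M aⱼ) inv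
  ... | inv | no bᵢ | no bⱼ = invariant-bypass (bypasses walk-i g<M bᵢ) (bypasses walk-j g<M bⱼ) inv

  meets-odd⇔prec : ∀ {g} → suc g ≤ M → passes (π i) (int (suc g)) → passes (π j) (int (suc g)) →
    (T (meetsB (π i) (π j) (int (suc g))) × Odd (crossings g)) ⇔ Prec n F π (suc g) j i
  meets-odd⇔prec {g} g<M passᵢ passⱼ = mk⇔ to from
    where
    eᵢ = passes⇒Enters walk-i g<M passᵢ
    eⱼ = passes⇒Enters walk-j g<M passⱼ
    inv = invariant g (<⇒≤ g<M)

    meets≡ : meetsB (π i) (π j) (int (suc g)) ≡ not (cᵢ g ==E cⱼ g)
    meets≡ = meetsB-just {π i} {π j} (Enters.inEdge-at eᵢ) (Enters.inEdge-at eⱼ)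

    to : T (meetsB (π i) (π j) (int (suc g))) × Odd (crossings g) → Prec n F π (suc g) j i
    to (meet , odd) = cⱼ g , cᵢ g , Enters.inEdge-at eⱼ , Enters.inEdge-at eᵢ ,
      <ᵇ-true⁻ (trans (sym (apart inv apart′)) (Odd⇒parity (crossings g) odd))
      where
      apart′ : cᵢ g ≢ cⱼ g
      apart′ same = subst T (trans meets≡ (cong not (==E-true same))) meet

    from : Prec n F π (suc g) j i → T (meetsB (π i) (π j) (int (suc g))) × Odd (crossings g)
    from (e , e′ , inⱼ , inᵢ , lower)
      with refl ← just-injective (trans (sym inⱼ) (Enters.inEdge-at eⱼ))
         | refl ← just-injective (trans (sym inᵢ) (Enters.inEdge-at eᵢ)) =
      subst T (sym (trans meets≡ (cong not (==E-false apart′)))) _ ,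
      parity⇒Odd (crossings g) (trans (apart inv apart′) (<ᵇ-true lower))
      where
      apart′ : cᵢ g ≢ cⱼ g
      apart′ same = <-irrefl (cong lv (sym same)) lower

lemma3p4 : (n : ℕ) (F : Star) → WF n F → (π : ℕ → List Edge) → CoveringFamily n F π →
    (k : ℕ) → 1 ≤ k → k ≤ size F → (i j : ℕ) → 1 ≤ i → i ≤ n → 1 ≤ j → j ≤ n →
    passes (π i) (int k) → passes (π j) (int k) →
    Defect n F π i j k ⇔ (i < j × Prec n F π k j i)
-- The intervals need not lie in [n]: only their convexity is used.
lemma3p4 n F _ π (walks , _) (suc g) _ k≤m i j 1≤i i≤n 1≤j j≤n passᵢ passⱼ = mk⇔
  (λ (i<j , defect) → i<j , Equivalence.to (meets-odd⇔prec i<j) defect)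
  (λ (i<j , prec) → i<j , Equivalence.from (meets-odd⇔prec i<j) prec)
  where
  meets-odd⇔prec : i < j →
    (T (meetsB (π i) (π j) (int (suc g))) × Odd (crossingsBefore n F (π i) (π j) (suc g)))
      ⇔ Prec n F π (suc g) j i
  meets-odd⇔prec i<j =
    CrossingParity.meets-odd⇔prec n F π (walks i 1≤i i≤n) (walks j 1≤j j≤n) i<j k≤m passᵢ passⱼ
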